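{- For $q_0$ even, let $s_*(q_0)\ge 3$ denote the least odd integer $s\ge3$ satisfying $$q_0^s-q_0^{s/2}\left(\frac{q_0}{2}\right)^{q_0-1}\left(2q_0^2-7q_0+3\right)>\left(\frac{q_0}{2}\right)^{q_0-1}\left(4q_0-2\right)-q_0^2.$$ Then (i) $s_*(2)=3$ and $s_*(4)=7$; (ii) if $q_0\ge 8$, then $s_*(q_0)$ is an odd number with $$2q_0+2-\frac{2(q_0-1)\log 2}{\log q_0}<s_*(q_0)<2q_0+4-\frac{2(q_0-2)\log 2}{\log q_0}.$$
   Context: $q_0$ is a power of $2$; $\log$ denotes the natural logarithm. -}

module Defs where

open import Data.Nat using (ℕ; _∸_; _^_) renaming (_≤_ to _≤ℕ_; _<_ to _<ℕ_)
open import Data.Integer using (ℤ; +_; _+_; _-_; _*_; _<_; _≤_; _>_; 0ℤ)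
open import Data.Product using (_×_)
open import Data.Sum using (_⊎_)
open import Relation.Nullary using (¬_)
open import Data.Nat using (suc) renaming (_*_ to _*ℕ_)
open import Data.Product using (∃-syntax)
open import Relation.Binary.PropositionalEquality using (_≡_)

Odd : ℕ → Set
Odd s = ∃[ m ] s ≡ suc (2 *ℕ m)

-- Real-free encoding of the real inequality  a > √Y · M  (for Y ≥ 0),
-- by the exact case analysis on the sign of M:
--   M > 0 :  a > √Y·M  ⇔  a > 0 ∧ a² > Y·M²
--   M ≤ 0 :  a > √Y·M  ⇔  a > 0 ∨ a² < Y·M²
GtSqrtMul : ℤ → ℤ → ℤ → Set
GtSqrtMul a Y M =
  (M > 0ℤ × (a > 0ℤ × a * a > Y * (M * M)))
  ⊎ (M ≤ 0ℤ × (a > 0ℤ ⊎ a * a < Y * (M * M)))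

-- q₀ = 2^k (a power of 2; even means k ≥ 1).
q₀ : ℕ → ℕ
q₀ k = 2 ^ k

-- (q₀/2)^(q₀-1) = (2^(k-1))^(q₀-1)
Aq : ℕ → ℤ
Aq k = + ((2 ^ (k ∸ 1)) ^ (q₀ k ∸ 1))

Bq : ℕ → ℤ
Bq k = (+ 2) * (+ q₀ k) * (+ q₀ k) - (+ 7) * (+ q₀ k) + (+ 3)

-- The defining inequality of s_*, for q₀ = 2^k:
--   q₀^s - q₀^(s/2) (q₀/2)^(q₀-1) (2q₀²-7q₀+3) > (q₀/2)^(q₀-1)(4q₀-2) - q₀²
-- rearranged (exactly) as
--   q₀^s + q₀² - (q₀/2)^(q₀-1)(4q₀-2)  >  √(q₀^s) · [(q₀/2)^(q₀-1)(2q₀²-7q₀+3)]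
Cond : ℕ → ℕ → Set
Cond k s =
  GtSqrtMul (+ (q₀ k ^ s) + (+ q₀ k) * (+ q₀ k) - Aq k * ((+ 4) * (+ q₀ k) - (+ 2)))
            (+ (q₀ k ^ s))
            (Aq k * Bq k)

IsSStar : ℕ → ℕ → Set
IsSStar k s = Odd s × 3 ≤ℕ s × Cond k s
  × (∀ t → Odd t → 3 ≤ℕ t → t <ℕ s → ¬ Cond k t)

{-# OPTIONS --safe #-}
-- Write q = q₀, A = (q/2)^(q−1), B = 2q² − 7q + 3 and X = q^s. The defining inequality
-- reads X − u > √X·AB with u = A(4q − 2) − q² > 0, and AB + v = 2Aq² =: P for
-- v = A(7q − 3) > u. If P² ≤ X then √X ≥ AB + v, which forces (X − u)² > X(AB)², so the
-- inequality holds. If 2X ≤ P², then X ≤ (AB)² as soon as 2q⁴ ≤ B² (true for q ≥ 14),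
-- so X − u < X ≤ √X·AB and it fails. For q = 2^k ≥ 16 both X = 2^(ks) and P = 2^e are
-- powers of 2, hence the inequality holds exactly when ks ≥ 2e: s_* is the least odd s
-- with ks ≥ 2e, so 2e ≤ k s_* < 2e + 2k, and these are the bounds of (ii) multiplied by k.
-- The cases q₀ = 2, 4, 8 are settled by evaluation.
module Submission where

open import Defs
open import Data.Nat using (ℕ; _^_) renaming (_≤_ to _≤ℕ_)
open import Data.Product using (_×_; ∃-syntax; _,_)
open import Data.Sum using (inj₁; inj₂)
open import Function using (id)
open import Relation.Nullary using (¬_; yes; no)
open import Relation.Binary.PropositionalEquality
  using (_≡_; refl; sym; trans; cong; cong₂; subst; subst₂; module ≡-Reasoning)
import Data.Nat as ℕ
import Data.Nat.Properties as ℕₚ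

module _ where
  open import Data.Nat
    using (zero; suc; _+_; _*_; _<_; _≤_; z≤n; s≤s; NonZero; >-nonZero; >-nonZero⁻¹)
  open import Data.Nat.Properties
  open import Data.Nat.Tactic.RingSolver using (solve-∀)

  X*m²<n² : ∀ {n u v m X} → n + u ≡ X → 1 ≤ m → u < v → (m + v) * (m + v) ≤ X →
            X * (m * m) < n * n
  X*m²<n² {n} {u} {v} {m} refl 1≤m u<v bound =
    +-cancelʳ-< (X * (2 * u)) (X * (m * m)) (n * n) (begin-strict
      X * (m * m) + X * (2 * u)             <⟨ +-monoʳ-< (X * (m * m)) (*-monoʳ-< X 2u<2mv+v²) ⟩
      X * (m * m) + X * (2 * m * v + v * v) ≡⟨ expand X m v ⟩
      X * ((m + v) * (m + v))               ≤⟨ *-monoʳ-≤ X bound ⟩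
      X * X                                 ≤⟨ m≤m+n (X * X) (u * u) ⟩
      X * X + u * u                         ≡⟨ complete n u ⟩
      n * n + X * (2 * u)                   ∎)
    where
    open ≤-Reasoning
    X : ℕ
    X = n + u
    1≤m+v : 1 ≤ m + v
    1≤m+v = ≤-trans 1≤m (m≤m+n m v)
    instance
      X≢0 : NonZero X
      X≢0 = >-nonZero (≤-trans (*-mono-≤ 1≤m+v 1≤m+v) bound)
    2u<2mv+v² : 2 * u < 2 * m * v + v * v
    2u<2mv+v² = begin-strict
      2 * u             <⟨ *-monoʳ-< 2 u<v ⟩
      2 * v             ≤⟨ *-monoˡ-≤ v (*-monoʳ-≤ 2 1≤m) ⟩
      2 * m * v         ≤⟨ m≤m+n (2 * m * v) (v * v) ⟩
      2 * m * v + v * v ∎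
    expand : ∀ X m v → X * (m * m) + X * (2 * m * v + v * v) ≡ X * ((m + v) * (m + v))
    expand = solve-∀
    complete : ∀ n u → (n + u) * (n + u) + u * u ≡ n * n + (n + u) * (2 * u)
    complete = solve-∀

  3m≤2n⇒2m²≤n² : ∀ {m n} → 3 * m ≤ 2 * n → 2 * (m * m) ≤ n * n
  3m≤2n⇒2m²≤n² {m} {n} 3m≤2n = *-cancelˡ-≤ 4 (begin
      4 * (2 * (m * m))         ≤⟨ m≤m+n (4 * (2 * (m * m))) (m * m) ⟩
      4 * (2 * (m * m)) + m * m ≡⟨ nine m ⟩
      (3 * m) * (3 * m)         ≤⟨ *-mono-≤ 3m≤2n 3m≤2n ⟩
      (2 * n) * (2 * n)         ≡⟨ four n ⟩
      4 * (n * n)               ∎)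
    where
    open ≤-Reasoning
    nine : ∀ m → 4 * (2 * (m * m)) + m * m ≡ (3 * m) * (3 * m)
    nine = solve-∀
    four : ∀ n → (2 * n) * (2 * n) ≡ 4 * (n * n)
    four = solve-∀

  X≤[AB]² : ∀ {A Q B X} → 2 * (Q * Q) ≤ B * B → 2 * X ≤ 2 * (A * Q) * (2 * (A * Q)) →
            X ≤ (A * B) * (A * B)
  X≤[AB]² {A} {Q} {B} {X} 2Q²≤B² 2X≤P² = *-cancelˡ-≤ 2 (begin
    2 * X                           ≤⟨ 2X≤P² ⟩
    2 * (A * Q) * (2 * (A * Q))     ≡⟨ regroup A Q ⟩
    2 * ((A * A) * (2 * (Q * Q)))   ≤⟨ *-monoʳ-≤ 2 (*-monoʳ-≤ (A * A) 2Q²≤B²) ⟩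
    2 * ((A * A) * (B * B))         ≡⟨ cong (2 *_) (square-product A B) ⟩
    2 * ((A * B) * (A * B))         ∎)
    where
    open ≤-Reasoning
    regroup : ∀ A Q → 2 * (A * Q) * (2 * (A * Q)) ≡ 2 * ((A * A) * (2 * (Q * Q)))
    regroup = solve-∀
    square-product : ∀ A B → (A * A) * (B * B) ≡ (A * B) * (A * B)
    square-product = solve-∀

  ceiling-multiple : ∀ d .{{_ : NonZero d}} T → ∃[ n ] (T ≤ d * n × d * n < T + d)
  ceiling-multiple d zero = 0 , z≤n , subst (_< d) (sym (*-zeroʳ d)) (>-nonZero⁻¹ d)
  ceiling-multiple d (suc T) with ceiling-multiple d T
  ... | n , T≤dn , dn<T+d with T ≟ d * n
  ...   | no T≢dn = n , ≤∧≢⇒< T≤dn T≢dn , m<n⇒m<1+n dn<T+d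
  ...   | yes T≡dn = suc n , subst (suc T ≤_) (sym d[1+n]≡d+T) (+-monoˡ-≤ T (>-nonZero⁻¹ d))
                         , subst (_< suc (T + d)) (sym d[1+n]≡d+T) (s≤s (≤-reflexive (+-comm d T)))
    where
    d[1+n]≡d+T : d * suc n ≡ d + T
    d[1+n]≡d+T = trans (*-suc d n) (cong (d +_) (sym T≡dn))

  least-odd-multiple : ∀ k .{{_ : NonZero k}} N → k < N →
    ∃[ n ] (1 ≤ n × N ≤ k * suc (2 * n) × k * suc (2 * n) < N + 2 * k
            × (∀ {m} → m < n → k * suc (2 * m) < N))
  least-odd-multiple k N k<N with m≤n⇒∃[o]m+o≡n (<⇒≤ k<N)
  ... | T , refl with ceiling-multiple (2 * k) {{m*n≢0 2 k}} T
  ... | n , T≤2kn , 2kn<T+2k = n , 1≤n , lower , upper , minimal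
    where
    odd-multiple : ∀ k n → k * suc (2 * n) ≡ k + 2 * k * n
    odd-multiple = solve-∀
    0<T : 0 < T
    0<T = +-cancelˡ-< k 0 T (subst (_< k + T) (sym (+-identityʳ k)) k<N)
    1≤n : 1 ≤ n
    1≤n = n≢0⇒n>0 λ { refl → <⇒≱ 0<T (≤-trans T≤2kn (≤-reflexive (*-zeroʳ (2 * k))))}
    lower : k + T ≤ k * suc (2 * n)
    lower = subst (k + T ≤_) (sym (odd-multiple k n)) (+-monoʳ-≤ k T≤2kn)
    upper : k * suc (2 * n) < k + T + 2 * k
    upper = subst₂ _<_ (sym (odd-multiple k n)) (sym (+-assoc k T (2 * k))) (+-monoʳ-< k 2kn<T+2k)
    minimal : ∀ {m} → m < n → k * suc (2 * m) < k + T
    minimal {m} m<n = subst (_< k + T) (sym (odd-multiple k m)) (+-monoʳ-< k 2km<T)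
      where
      2km<T : 2 * k * m < T
      2km<T = +-cancelʳ-< (2 * k) (2 * k * m) T (begin-strict
        2 * k * m + 2 * k ≡⟨ +-comm (2 * k * m) (2 * k) ⟩
        2 * k + 2 * k * m ≡⟨ *-suc (2 * k) m ⟨
        2 * k * suc m     ≤⟨ *-monoʳ-≤ (2 * k) m<n ⟩
        2 * k * n         <⟨ 2kn<T+2k ⟩
        T + 2 * k         ∎)
        where open ≤-Reasoning

module _ where
  open import Data.Integer
    using (0ℤ; +_; _⊖_; _+_; _-_; _*_; _<_; _≤_; +<+; Positive; positive; NonNegative; nonNegative)
  open import Data.Integer.Properties
  open import Data.Integer.Tactic.RingSolver using (solve-∀)

  gtSqrtMul-fails : ∀ {a X M} → 0ℤ < M → a < X → X ≤ M * M → ¬ GtSqrtMul a X M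
  gtSqrtMul-fails {a} {X} {M} _ a<X X≤M² (inj₁ (_ , 0<a , XM²<a²)) = <-asym XM²<a² (begin-strict
      a * a       <⟨ *-monoˡ-<-pos a a<X ⟩
      a * X       <⟨ *-monoʳ-<-pos X a<X ⟩
      X * X       ≤⟨ *-monoˡ-≤-nonNeg X X≤M² ⟩
      X * (M * M) ∎)
    where
    open ≤-Reasoning
    0<X : 0ℤ < X
    0<X = <-trans 0<a a<X
    instance
      a>0 : Positive a
      a>0 = positive 0<a
      X>0 : Positive X
      X>0 = positive 0<X
      X≥0 : NonNegative X
      X≥0 = nonNegative (<⇒≤ 0<X)
  gtSqrtMul-fails 0<M _ _ (inj₂ (M≤0 , _)) = <⇒≱ 0<M M≤0

  gtSqrtMul-holds : ∀ X u v m → 1 ℕ.≤ m → u ℕ.< v → (m ℕ.+ v) ℕ.* (m ℕ.+ v) ℕ.≤ X →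
                    GtSqrtMul (X ⊖ u) (+ X) (+ m)
  gtSqrtMul-holds X u v m 1≤m u<v bound =
    subst (λ a → GtSqrtMul a (+ X) (+ m)) (sym (⊖-≥ (ℕₚ.<⇒≤ u<X)))
      (inj₁ (+<+ 1≤m , +<+ (ℕₚ.m<n⇒0<n∸m u<X) , subst₂ _<_ X*m²≡ (pos-* n n) (+<+ gap)))
    where
    n : ℕ
    n = X ℕ.∸ u
    m+v≢0 : ℕ.NonZero (m ℕ.+ v)
    m+v≢0 = ℕ.>-nonZero (ℕₚ.≤-trans 1≤m (ℕₚ.m≤m+n m v))
    u<X : u ℕ.< X
    u<X = ℕₚ.<-≤-trans u<v (ℕₚ.≤-trans (ℕₚ.m≤n+m v m)
            (ℕₚ.≤-trans (ℕₚ.m≤m*n (m ℕ.+ v) (m ℕ.+ v) {{m+v≢0}}) bound))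
    gap : X ℕ.* (m ℕ.* m) ℕ.< n ℕ.* n
    gap = X*m²<n² (ℕₚ.m∸n+n≡m (ℕₚ.<⇒≤ u<X)) 1≤m u<v bound
    X*m²≡ : + (X ℕ.* (m ℕ.* m)) ≡ + X * (+ m * + m)
    X*m²≡ = trans (pos-* X (m ℕ.* m)) (cong (+ X *_) (pos-* m m))

  -- Cond k t is, definitionally, CondAt q₀ A (q₀ ^ t) with A = (q₀/2)^(q₀ − 1).
  CondAt : ℕ → ℕ → ℕ → Set
  CondAt q A X = GtSqrtMul (+ X + (+ q) * (+ q) - (+ A) * ((+ 4) * (+ q) - (+ 2)))
                           (+ X)
                           ((+ A) * ((+ 2) * (+ q) * (+ q) - (+ 7) * (+ q) + (+ 3)))

  condAt[4+r]≡gtSqrtMul : ∀ r A X u →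
    u ℕ.+ (4 ℕ.+ r) ℕ.* (4 ℕ.+ r) ≡ A ℕ.* (14 ℕ.+ 4 ℕ.* r) →
    CondAt (4 ℕ.+ r) A X ≡ GtSqrtMul (X ⊖ u) (+ X) (+ (A ℕ.* ((7 ℕ.+ 2 ℕ.* r) ℕ.* (1 ℕ.+ r))))
  condAt[4+r]≡gtSqrtMul r A X u u+q²≡AW = cong₂ (λ a M → GtSqrtMul a (+ X) M) a≡X⊖u M≡AB
    where
    open ≡-Reasoning
    q W B : ℕ
    q = 4 ℕ.+ r
    W = 14 ℕ.+ 4 ℕ.* r
    B = (7 ℕ.+ 2 ℕ.* r) ℕ.* (1 ℕ.+ r)
    linear : ∀ x → + 4 * (+ 4 + x) - + 2 ≡ + 14 + + 4 * x
    linear = solve-∀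
    quadratic : ∀ x → + 2 * (+ 4 + x) * (+ 4 + x) - + 7 * (+ 4 + x) + + 3
                      ≡ (+ 7 + + 2 * x) * (+ 1 + x)
    quadratic = solve-∀
    cancel : ∀ x y z → x + y - (z + y) ≡ x - z
    cancel = solve-∀
    a≡X⊖u : + X + + q * + q - + A * (+ 4 * + q - + 2) ≡ X ⊖ u
    a≡X⊖u = begin
      + X + + q * + q - + A * (+ 4 * + q - + 2)
        ≡⟨ cong (λ w → + X + + q * + q - + A * w) (linear (+ r)) ⟩
      + X + + q * + q - + A * (+ 14 + + 4 * + r)
        ≡⟨ cong (λ w → + X + + q * + q - + A * (+ 14 + w)) (pos-* 4 r) ⟨
      + X + + q * + q - + A * + W
        ≡⟨ cong₂ (λ Q AW → + X + Q - AW) (pos-* q q) (pos-* A W) ⟨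
      + X + + (q ℕ.* q) - + (A ℕ.* W)
        ≡⟨ cong (λ AW → + X + + (q ℕ.* q) - + AW) u+q²≡AW ⟨
      + X + + (q ℕ.* q) - (+ u + + (q ℕ.* q))
        ≡⟨ cancel (+ X) (+ (q ℕ.* q)) (+ u) ⟩
      + X - + u
        ≡⟨ m-n≡m⊖n X u ⟩
      X ⊖ u
        ∎
    M≡AB : + A * (+ 2 * + q * + q - + 7 * + q + + 3) ≡ + (A ℕ.* B)
    M≡AB = begin
      + A * (+ 2 * + q * + q - + 7 * + q + + 3)
        ≡⟨ cong (+ A *_) (quadratic (+ r)) ⟩
      + A * ((+ 7 + + 2 * + r) * (+ 1 + + r))
        ≡⟨ cong (λ x → + A * ((+ 7 + x) * (+ 1 + + r))) (pos-* 2 r) ⟨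
      + A * (+ (7 ℕ.+ 2 ℕ.* r) * + (1 ℕ.+ r))
        ≡⟨ cong (+ A *_) (pos-* (7 ℕ.+ 2 ℕ.* r) (1 ℕ.+ r)) ⟨
      + A * + B
        ≡⟨ pos-* A B ⟨
      + (A ℕ.* B)
        ∎

module _ where
  open import Data.Nat
    using (suc; _+_; _*_; _∸_; _<_; _≤_; z≤n; s≤s; s≤s⁻¹; s<s⁻¹; >-nonZero)
  open import Data.Nat.Properties
  open import Data.Nat.Tactic.RingSolver using (solve-∀)
  import Data.Integer as ℤ
  import Data.Integer.Properties as ℤₚ

  pivot : ℕ → ℕ → ℕ
  pivot q A = 2 * (A * (q * q))

  private
    module AtLeast4 (r A : ℕ) (q≤A : 4 + r ≤ A) where
      -- W, B and V are 4q − 2, 2q² − 7q + 3 = (2q − 1)(q − 3) and 7q − 3 at q = 4 + r.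
      q W B V : ℕ
      q = 4 + r
      W = 14 + 4 * r
      B = (7 + 2 * r) * (1 + r)
      V = 25 + 7 * r

      q<W : q < W
      q<W = +-mono-≤ (m≤m+n 5 9) (m≤n*m r 4)

      W<V : W < V
      W<V = +-mono-≤ (m≤m+n 15 10) (*-monoˡ-≤ r (m≤m+n 4 3))

      1≤A : 1 ≤ A
      1≤A = ≤-trans (s≤s z≤n) q≤A

      q²<AW : q * q < A * W
      q²<AW = begin-strict
        q * q <⟨ *-monoʳ-< q q<W ⟩
        q * W ≤⟨ *-monoˡ-≤ W q≤A ⟩
        A * W ∎
        where open ≤-Reasoning

      u : ℕ
      u = A * W ∸ q * q

      condAt≡gtSqrtMul : ∀ X → CondAt q A X ≡ GtSqrtMul (X ℤ.⊖ u) (ℤ.+ X) (ℤ.+ (A * B))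
      condAt≡gtSqrtMul X = condAt[4+r]≡gtSqrtMul r A X u (m∸n+n≡m (<⇒≤ q²<AW))

      0<u : 0 < u
      0<u = m<n⇒0<n∸m q²<AW

      1≤AB : 1 ≤ A * B
      1≤AB = *-mono-≤ 1≤A (s≤s z≤n)

      u<AV : u < A * V
      u<AV = ≤-<-trans (m∸n≤m (A * W) (q * q)) (*-monoʳ-< A {{>-nonZero 1≤A}} W<V)

      AB+AV≡pivot : A * B + A * V ≡ pivot q A
      AB+AV≡pivot = identity A r
        where
        identity : ∀ A r → A * ((7 + 2 * r) * (1 + r)) + A * (25 + 7 * r)
                           ≡ 2 * (A * ((4 + r) * (4 + r)))
        identity = solve-∀

      3q²≤2B : 10 ≤ r → 3 * (q * q) ≤ 2 * B
      3q²≤2B 10≤r with m≤n⇒∃[o]m+o≡n 10≤r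
      ... | s , refl = subst (3 * (q * q) ≤_) (identity s) (m≤m+n (3 * (q * q)) (6 + 14 * s + s * s))
        where
        identity : ∀ s → 3 * ((4 + (10 + s)) * (4 + (10 + s))) + (6 + 14 * s + s * s)
                         ≡ 2 * ((7 + 2 * (10 + s)) * (1 + (10 + s)))
        identity = solve-∀

  condAt-fails : ∀ {q A X} → 14 ≤ q → q ≤ A → 2 * X ≤ pivot q A * pivot q A → ¬ CondAt q A X
  condAt-fails {A = A} {X} 14≤q q≤A 2X≤P²
    with m≤n⇒∃[o]m+o≡n (≤-trans (m≤m+n 4 10) 14≤q)
  ... | r , refl = subst ¬_ (sym (condAt≡gtSqrtMul X)) fails
    where
    open AtLeast4 r A q≤A
    2q⁴≤B² : 2 * ((q * q) * (q * q)) ≤ B * B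
    2q⁴≤B² = 3m≤2n⇒2m²≤n² {q * q} {B} (3q²≤2B (+-cancelˡ-≤ 4 10 r 14≤q))
    X≤M² : X ≤ (A * B) * (A * B)
    X≤M² = X≤[AB]² {A} {q * q} {B} {X} 2q⁴≤B² 2X≤P²
    fails : ¬ GtSqrtMul (X ℤ.⊖ u) (ℤ.+ X) (ℤ.+ (A * B))
    fails = gtSqrtMul-fails (ℤ.+<+ 1≤AB) (ℤₚ.m⊖1+n<m X u {{>-nonZero 0<u}})
              (subst (ℤ.+ X ℤ.≤_) (ℤₚ.pos-* (A * B) (A * B)) (ℤ.+≤+ X≤M²))

  condAt-holds : ∀ {q A X} → 4 ≤ q → q ≤ A → pivot q A * pivot q A ≤ X → CondAt q A X
  condAt-holds {A = A} {X} 4≤q q≤A P²≤X with m≤n⇒∃[o]m+o≡n 4≤q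
  ... | r , refl = subst id (sym (condAt≡gtSqrtMul X))
                     (gtSqrtMul-holds X u (A * V) (A * B) 1≤AB u<AV
                       (subst (λ P → P * P ≤ X) (sym AB+AV≡pivot) P²≤X))
    where open AtLeast4 r A q≤A

  isSStar[2n+1] : ∀ {k} n → 1 ≤ n → Cond k (suc (2 * n)) →
                  (∀ {m} → m < n → 1 ≤ m → ¬ Cond k (suc (2 * m))) → IsSStar k (suc (2 * n))
  isSStar[2n+1] {k} n 1≤n holds below = (n , refl) , s≤s (*-monoʳ-≤ 2 1≤n) , holds , earlier
    where
    earlier : ∀ t → Odd t → 3 ≤ t → t < suc (2 * n) → ¬ Cond k t
    earlier .(suc (2 * m)) (m , refl) 3≤t t<s =
      below (*-cancelˡ-< 2 m n (s<s⁻¹ t<s)) (*-cancelˡ-≤ 2 (s≤s⁻¹ 3≤t))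

  -- 2 ^ pivotExponent j p = 2 A q² for q = 1 + p = 2^(1 + j) and A = (q/2)^(q − 1) = 2^(j p).
  pivotExponent : ℕ → ℕ → ℕ
  pivotExponent j p = suc (j * p + (suc j + suc j))

  module PowerAtLeast16 (j : ℕ) (3≤j : 3 ≤ j) where
    k q p A e N : ℕ
    k = suc j
    q = q₀ k
    p = q ∸ 1
    A = (2 ^ j) ^ p
    e = pivotExponent j p
    N = e + e

    16≤q : 16 ≤ q
    16≤q = ^-monoʳ-≤ 2 (s≤s 3≤j)

    1+p≡q : suc p ≡ q
    1+p≡q = trans (+-comm 1 p) (m∸n+n≡m (≤-trans (s≤s z≤n) 16≤q))

    15≤p : 15 ≤ p
    15≤p = s≤s⁻¹ (≤-trans 16≤q (≤-reflexive (sym 1+p≡q)))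

    k≤jp : k ≤ j * p
    k≤jp = begin
      suc j   ≤⟨ +-monoˡ-≤ j (≤-trans (s≤s z≤n) 3≤j) ⟩
      j + j   ≡⟨ cong (j +_) (+-identityʳ j) ⟨
      2 * j   ≤⟨ *-monoˡ-≤ j (≤-trans (m≤m+n 2 13) 15≤p) ⟩
      p * j   ≡⟨ *-comm p j ⟩
      j * p   ∎
      where open ≤-Reasoning

    q≤A : q ≤ A
    q≤A = subst (q ≤_) (sym (^-*-assoc 2 j p)) (^-monoʳ-≤ 2 k≤jp)

    pivot²≡ : pivot q A * pivot q A ≡ 2 ^ N
    pivot²≡ = trans (cong₂ _*_ pivot≡ pivot≡) (sym (^-distribˡ-+-* 2 e e))
      where
      pivot≡ : pivot q A ≡ 2 ^ e
      pivot≡ = cong (2 *_) (trans (cong₂ _*_ (^-*-assoc 2 j p) (sym (^-distribˡ-+-* 2 k k)))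
                                  (sym (^-distribˡ-+-* 2 (j * p) (k + k))))

    cond-holds : ∀ {t} → N ≤ k * t → Cond k t
    cond-holds {t} N≤kt = condAt-holds (≤-trans (m≤m+n 4 12) 16≤q) q≤A
      (subst₂ _≤_ (sym pivot²≡) (sym (^-*-assoc 2 k t)) (^-monoʳ-≤ 2 N≤kt))

    cond-fails : ∀ {t} → k * t < N → ¬ Cond k t
    cond-fails {t} kt<N = condAt-fails (≤-trans (m≤m+n 14 2) 16≤q) q≤A
      (subst₂ _≤_ (cong (2 *_) (sym (^-*-assoc 2 k t))) (sym pivot²≡) (^-monoʳ-≤ 2 kt<N))

    k<N : k < N
    k<N = <-≤-trans (s≤s (≤-trans (m≤m+n k k) (m≤n+m (k + k) (j * p)))) (m≤m+n e e)

    s*-threshold : ∃[ s ] (IsSStar k s × Odd s × N ≤ k * s × k * s < N + 2 * k)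
    s*-threshold with least-odd-multiple k N k<N
    ... | n , 1≤n , N≤ks , ks<N+2k , minimal =
      suc (2 * n) , isSStar[2n+1] {k} n 1≤n (cond-holds N≤ks) (λ m<n _ → cond-fails (minimal m<n))
                  , (n , refl) , N≤ks , ks<N+2k

open import Data.Integer using (+_; _+_; _-_; _*_; _<_; ℤ; 0ℤ; _⊖_; +≤+; +<+)
open import Data.Integer.Properties
  using (_<?_; _≤?_; pos-*; m-n≡m⊖n; m⊖1+n<m; module ≤-Reasoning)
open import Data.Integer.Tactic.RingSolver using (solve-∀)
open import Data.Nat using (suc; z≤n; s≤s; NonZero; >-nonZero⁻¹)
open import Data.Nat.Properties using (allUpTo?)
open import Relation.Nullary using (Dec; ¬?; _×-dec_; _⊎-dec_; _→-dec_)
open import Relation.Nullary.Decidable using (True; toWitness)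

Bounds : ℕ → ℕ → ℕ → Set
Bounds k q s = (+ k) * ((+ 2) * (+ q) + (+ 2)) - (+ 2) * (+ q - + 1) < (+ k) * (+ s)
             × (+ k) * (+ s) < (+ k) * ((+ 2) * (+ q) + (+ 4)) - (+ 2) * (+ q - + 2)

-- Multiplied by k, the bounds of (ii) are exactly N − 2 and N + 2k.
threshold-bounds : ∀ j p s → let N = pivotExponent j p ℕ.+ pivotExponent j p in
                   N ≤ℕ suc j ℕ.* s → suc j ℕ.* s ℕ.< N ℕ.+ 2 ℕ.* suc j →
                   Bounds (suc j) (suc p) s
threshold-bounds j p s N≤ks ks<N+2k = lower , upper
  where
  open ≤-Reasoning
  N : ℕ
  N = pivotExponent j p ℕ.+ pivotExponent j p
  E : ℤ
  E = + 1 + (+ j * + p + (+ suc j + + suc j))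
  N≡E+E : + N ≡ E + E
  N≡E+E = cong (λ x → (+ 1 + (x + (+ suc j + + suc j))) + (+ 1 + (x + (+ suc j + + suc j))))
               (pos-* j p)
  lower-identity : ∀ J P → (+ 1 + J) * (+ 2 * (+ 1 + P) + + 2) - + 2 * ((+ 1 + P) - + 1)
                           ≡ (+ 1 + (J * P + ((+ 1 + J) + (+ 1 + J))))
                             + (+ 1 + (J * P + ((+ 1 + J) + (+ 1 + J)))) - + 2
  lower-identity = solve-∀
  upper-identity : ∀ J P → (+ 1 + J) * (+ 2 * (+ 1 + P) + + 4) - + 2 * ((+ 1 + P) - + 2)
                           ≡ (+ 1 + (J * P + ((+ 1 + J) + (+ 1 + J))))
                             + (+ 1 + (J * P + ((+ 1 + J) + (+ 1 + J)))) + + 2 * (+ 1 + J)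
  upper-identity = solve-∀
  lower : (+ suc j) * ((+ 2) * (+ suc p) + (+ 2)) - (+ 2) * (+ suc p - + 1) < (+ suc j) * (+ s)
  lower = begin-strict
    (+ suc j) * ((+ 2) * (+ suc p) + (+ 2)) - (+ 2) * (+ suc p - + 1)
      ≡⟨ lower-identity (+ j) (+ p) ⟩
    E + E - + 2
      ≡⟨ cong (_- + 2) N≡E+E ⟨
    + N - + 2
      ≡⟨ m-n≡m⊖n N 2 ⟩
    N ⊖ 2
      <⟨ m⊖1+n<m N 2 ⟩
    + N
      ≤⟨ +≤+ N≤ks ⟩
    + (suc j ℕ.* s)
      ≡⟨ pos-* (suc j) s ⟩
    + suc j * + s
      ∎
  upper : (+ suc j) * (+ s) < (+ suc j) * ((+ 2) * (+ suc p) + (+ 4)) - (+ 2) * (+ suc p - + 2)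
  upper = begin-strict
    + suc j * + s
      ≡⟨ pos-* (suc j) s ⟨
    + (suc j ℕ.* s)
      <⟨ +<+ ks<N+2k ⟩
    + N + + (2 ℕ.* suc j)
      ≡⟨ cong₂ _+_ N≡E+E (pos-* 2 (suc j)) ⟩
    E + E + + 2 * + suc j
      ≡⟨ upper-identity (+ j) (+ p) ⟨
    (+ suc j) * ((+ 2) * (+ suc p) + (+ 4)) - (+ 2) * (+ suc p - + 2)
      ∎

gtSqrtMul? : ∀ a X M → Dec (GtSqrtMul a X M)
gtSqrtMul? a X M = (0ℤ <? M ×-dec (0ℤ <? a ×-dec X * (M * M) <? a * a))
             ⊎-dec (M ≤? 0ℤ ×-dec (0ℤ <? a ⊎-dec a * a <? X * (M * M)))

cond? : ∀ k t → Dec (Cond k t)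
cond? k t = gtSqrtMul? (+ (q₀ k ^ t) + (+ q₀ k) * (+ q₀ k) - Aq k * ((+ 4) * (+ q₀ k) - (+ 2)))
                       (+ (q₀ k ^ t)) (Aq k * Bq k)

isSStar-by-evaluation : ∀ k n .{{_ : NonZero n}} →
  {True (cond? k (suc (2 ℕ.* n)))} →
  {True (allUpTo? (λ m → 1 ℕ.≤? m →-dec ¬? (cond? k (suc (2 ℕ.* m)))) n)} →
  IsSStar k (suc (2 ℕ.* n))
isSStar-by-evaluation k n {holds} {below} =
  isSStar[2n+1] {k} n (>-nonZero⁻¹ n) (toWitness holds) (toWitness below)

s*-estimate-large : ∀ j → 3 ≤ℕ j →
                    ∃[ s ] (IsSStar (suc j) s × Odd s × Bounds (suc j) (q₀ (suc j)) s)
s*-estimate-large j 3≤j =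
  let s , sstar , odd , N≤ks , ks<N+2k = s*-threshold in
  s , sstar , odd , subst (λ q → Bounds (suc j) q s) 1+p≡q (threshold-bounds j p s N≤ks ks<N+2k)
  where open PowerAtLeast16 j 3≤j

s*-estimate : ∀ k → 3 ≤ℕ k → ∃[ s ] (IsSStar k s × Odd s × Bounds k (q₀ k) s)
s*-estimate 0 ()
s*-estimate 1 (s≤s ())
s*-estimate 2 (s≤s (s≤s ()))
s*-estimate 3 _ = 15 , isSStar-by-evaluation 3 7 , (7 , refl)
                , threshold-bounds 2 7 15 (ℕₚ.m≤m+n 42 3) (ℕₚ.m≤m+n 46 2)
s*-estimate (suc j@(suc (suc (suc _)))) _ = s*-estimate-large j (s≤s (s≤s (s≤s z≤n)))

-- q₀ = 2^k; since log 2 / log q₀ = 1/k, the bounds of (ii) appear multiplied by k.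
lemmax4 : (IsSStar 1 3 × IsSStar 2 7)
    × (∀ k → 3 ≤ℕ k → ∃[ s ] (IsSStar k s × Odd s
        × (+ k) * ((+ 2) * (+ q₀ k) + (+ 2)) - (+ 2) * (+ q₀ k - + 1) < (+ k) * (+ s)
        × (+ k) * (+ s) < (+ k) * ((+ 2) * (+ q₀ k) + (+ 4)) - (+ 2) * (+ q₀ k - + 2)))
lemmax4 = (isSStar-by-evaluation 1 1 , isSStar-by-evaluation 2 3) , s*-estimate
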